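{- Let $P,P'\in\widehat{\mathcal P}$ with $P\succeq^{+}P'$. If $P\xrightarrow{\sigma}_2P_1$, then there exists $P_1'$ such that $P'\xrightarrow{\sigma}_1P_1'$ and $P_1\succeq^{+}P_1'$.
   Context: TACS. Fix a countable set $\Lambda$ of action names; $\overline{\Lambda}=\{\overline a : a\in\Lambda\}$ with $\overline{\overline a}=a$; $\mathcal A=\Lambda\cup\overline\Lambda\cup\{\tau\}$, and $a$ ranges over $\Lambda\cup\overline\Lambda$. Terms (set $\widehat{\mathcal P}$, possibly open) are generated by $P::=\mathbf 0\mid x\mid \alpha.P\mid \sigma.P\mid P+P\mid P|P\mid P\backslash L\mid P[f]\mid \mu x.P$, where $\alpha\in\mathcal A$, $x$ ranges over a countably infinite set of variables, $L\subseteq\mathcal A\setminus\{\tau\}$ is finite, and $f:\mathcal A\to\mathcal A$ satisfies $f(\tau)=\tau$, $f(\overline a)=\overline{f(a)}$ and $f(\alpha)\neq\alpha$ for only finitely many $\alpha$. $\mu x$ binds $x$; $P[Q/x]$ is substitution of $Q$ for the free occurrences of $x$. A variable is guarded in a term if each of its occurrences is in the scope of an action prefix $\alpha.\_$ (a $\sigma$-prefix does not count); in every term $\mu x.P$, $x$ must be guarded in $P$. $\overline L=\{\overline a: a\in L\}$. Urgent sets: $\mathcal U(\sigma.P)=\mathcal U(\mathbf 0)=\mathcal U(x)=\emptyset$, $\mathcal U(\alpha.P)=\{\alpha\}$, $\mathcal U(P+Q)=\mathcal U(P)\cup\mathcal U(Q)$, $\mathcal U(P|Q)=\mathcal U(P)\cup\mathcal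 U(Q)\cup\{\tau\mid \mathcal U(P)\cap\overline{\mathcal U(Q)}\neq\emptyset\}$, $\mathcal U(P\backslash L)=\mathcal U(P)\setminus(L\cup\overline L)$, $\mathcal U(P[f])=\{f(\alpha):\alpha\in\mathcal U(P)\}$, $\mathcal U(\mu x.P)=\mathcal U(P)$. Clock transitions $\xrightarrow{\sigma}_i$ ($i\in\{1,2\}$) on terms are the least relations with: $\mathbf 0\xrightarrow{\sigma}_i\mathbf 0$; $a.P\xrightarrow{\sigma}_i a.P$ for $a\in\Lambda\cup\overline\Lambda$; $\sigma.P\xrightarrow{\sigma}_iP$; if $P\xrightarrow{\sigma}_iP'$ then $\mu x.P\xrightarrow{\sigma}_iP'[\mu x.P/x]$, $P\backslash L\xrightarrow{\sigma}_iP'\backslash L$, $P[f]\xrightarrow{\sigma}_iP'[f]$; if $P\xrightarrow{\sigma}_iP'$ and $Q\xrightarrow{\sigma}_iQ'$ then $P+Q\xrightarrow{\sigma}_iP'+Q'$, and $P|Q\xrightarrow{\sigma}_iP'|Q'$ provided $\tau\notin\mathcal U(P|Q)$; and, only for $i=2$: if $P\xrightarrow{\sigma}_2P'$ then $\sigma.P\xrightarrow{\sigma}_2P'$. The syntactic relation $\succeq\subseteq\widehat{\mathcal P}\times\widehat{\mathcal P}$ is the smallest relation such that for all terms: $P\succeq P$; $P\succeq\sigma.P$; if $P'\succeq P$ and $Q'\succeq Q$ then $P'|Q'\succeq P|Q$ and $P'+Q'\succeq P+Q$; if $P'\succeq P$ then $P'\backslash L\succeq P\backslash L$ and $P'[f]\succeq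 P[f]$; if $P'\succeq P$ and $x$ is guarded in $P$ then $P'[\mu x.P/x]\succeq\mu x.P$. $\succeq^{+}$ denotes the transitive closure of $\succeq$. -}

module Defs where

open import Data.Nat using (ℕ; zero; suc; _≟_)
open import Data.Product using (_×_; _,_)
open import Data.Sum using (_⊎_)
open import Data.List using (List; []; _∷_)
open import Data.List.Membership.Propositional using (_∈_)
open import Data.Empty using (⊥)
open import Data.Unit using (⊤)
open import Relation.Nullary using (¬_; yes; no)
open import Relation.Binary.PropositionalEquality using (_≢_)
open import Relation.Binary.Construct.Closure.Transitive using (TransClosure)

-- Action names Λ = ℕ (countable).  Visible actions a ∈ Λ ∪ Λ̄.
data Label : Set where
  nm : ℕ → Label
  co : ℕ → Label

bar : Label → Label
bar (nm n) = co n
bar (co n) = nm n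

data Act : Set where
  lab : Label → Act
  τ   : Act

-- Relabelling functions f : 𝒜 → 𝒜 with f τ = τ, f ā = \overline{f a},
-- and finitely many non-identity points.  Such an f is determined by its
-- values on Λ, of which finitely many differ from the identity; we
-- represent it by a finite table of exceptions (name ↦ new label).
Relab : Set
Relab = List (ℕ × Label)

appName : Relab → ℕ → Label
appName []             n = nm n
appName ((m , l) ∷ fs) n with m ≟ n
... | yes _ = l
... | no  _ = appName fs n

relab : Relab → Act → Act
relab f (lab (nm n)) = lab (appName f n)
relab f (lab (co n)) = lab (bar (appName f n))
relab f τ            = τ

RSet : Set
RSet = List Label

InLL : Act → RSet → Set
InLL (lab a) L = (a ∈ L) ⊎ (bar a ∈ L)
InLL τ       L = ⊥

-- Terms, with variables as de Bruijn indices (μ binds index 0).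
data Term : Set where
  nil : Term
  var : ℕ → Term
  pre : Act → Term → Term
  sig : Term → Term
  _⊕_ : Term → Term → Term
  _∥_ : Term → Term → Term
  res : Term → RSet → Term
  rel : Term → Relab → Term
  rec : Term → Term

ext : (ℕ → ℕ) → ℕ → ℕ
ext ρ zero    = zero
ext ρ (suc n) = suc (ρ n)

rename : (ℕ → ℕ) → Term → Term
rename ρ nil       = nil
rename ρ (var n)   = var (ρ n)
rename ρ (pre α P) = pre α (rename ρ P)
rename ρ (sig P)   = sig (rename ρ P)
rename ρ (P ⊕ Q)   = rename ρ P ⊕ rename ρ Q
rename ρ (P ∥ Q)   = rename ρ P ∥ rename ρ Q
rename ρ (res P L) = res (rename ρ P) L
rename ρ (rel P f) = rel (rename ρ P) f
rename ρ (rec P)   = rec (rename (ext ρ) P)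

exts : (ℕ → Term) → ℕ → Term
exts s zero    = var zero
exts s (suc n) = rename suc (s n)

subst : (ℕ → Term) → Term → Term
subst s nil       = nil
subst s (var n)   = s n
subst s (pre α P) = pre α (subst s P)
subst s (sig P)   = sig (subst s P)
subst s (P ⊕ Q)   = subst s P ⊕ subst s Q
subst s (P ∥ Q)   = subst s P ∥ subst s Q
subst s (res P L) = res (subst s P) L
subst s (rel P f) = rel (subst s P) f
subst s (rec P)   = rec (subst (exts s) P)

sub0 : Term → ℕ → Term
sub0 Q zero    = Q
sub0 Q (suc n) = var n

-- P [ Q /x ]  where x is the variable bound by the enclosing μ (index 0)
_[_/x] : Term → Term → Term
P [ Q /x] = subst (sub0 Q) P

Guarded : ℕ → Term → Set
Guarded k nil       = ⊤
Guarded k (var n)   = n ≢ k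
Guarded k (pre α P) = ⊤
Guarded k (sig P)   = Guarded k P
Guarded k (P ⊕ Q)   = Guarded k P × Guarded k Q
Guarded k (P ∥ Q)   = Guarded k P × Guarded k Q
Guarded k (res P L) = Guarded k P
Guarded k (rel P f) = Guarded k P
Guarded k (rec P)   = Guarded (suc k) P

-- Membership in 𝒫̂: in every μx.P, x is guarded in P.
WF : Term → Set
WF nil       = ⊤
WF (var n)   = ⊤
WF (pre α P) = WF P
WF (sig P)   = WF P
WF (P ⊕ Q)   = WF P × WF Q
WF (P ∥ Q)   = WF P × WF Q
WF (res P L) = WF P
WF (rel P f) = WF P
WF (rec P)   = Guarded zero P × WF P

-- Urgent sets, as a membership predicate α ∈U P.
data _∈U_ : Act → Term → Set where
  u-pre  : ∀ {α P} → α ∈U pre α P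
  u-⊕l   : ∀ {α P Q} → α ∈U P → α ∈U (P ⊕ Q)
  u-⊕r   : ∀ {α P Q} → α ∈U Q → α ∈U (P ⊕ Q)
  u-∥l   : ∀ {α P Q} → α ∈U P → α ∈U (P ∥ Q)
  u-∥r   : ∀ {α P Q} → α ∈U Q → α ∈U (P ∥ Q)
  u-sync : ∀ {P Q} (a : Label) → lab a ∈U P → lab (bar a) ∈U Q → τ ∈U (P ∥ Q)
  u-res  : ∀ {α P L} → α ∈U P → ¬ InLL α L → α ∈U res P L
  u-rel  : ∀ {α P f} → α ∈U P → relab f α ∈U rel P f
  u-rec  : ∀ {α P} → α ∈U P → α ∈U rec P

data Idx : Set where
  one two : Idx

data _─σ[_]→_ : Term → Idx → Term → Set where
  c-nil  : ∀ {i} → nil ─σ[ i ]→ nil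
  c-pre  : ∀ {i a P} → pre (lab a) P ─σ[ i ]→ pre (lab a) P
  c-sig  : ∀ {i P} → sig P ─σ[ i ]→ P
  c-rec  : ∀ {i P P'} → P ─σ[ i ]→ P' → rec P ─σ[ i ]→ (P' [ rec P /x])
  c-res  : ∀ {i P P' L} → P ─σ[ i ]→ P' → res P L ─σ[ i ]→ res P' L
  c-rel  : ∀ {i P P' f} → P ─σ[ i ]→ P' → rel P f ─σ[ i ]→ rel P' f
  c-⊕    : ∀ {i P P' Q Q'} → P ─σ[ i ]→ P' → Q ─σ[ i ]→ Q' → (P ⊕ Q) ─σ[ i ]→ (P' ⊕ Q')
  c-∥    : ∀ {i P P' Q Q'} → P ─σ[ i ]→ P' → Q ─σ[ i ]→ Q' → ¬ (τ ∈U (P ∥ Q))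
           → (P ∥ Q) ─σ[ i ]→ (P' ∥ Q')
  c-sig2 : ∀ {P P'} → P ─σ[ two ]→ P' → sig P ─σ[ two ]→ P'

data _⪰_ : Term → Term → Set where
  s-refl : ∀ {P} → P ⪰ P
  s-sig  : ∀ {P} → P ⪰ sig P
  s-∥    : ∀ {P P' Q Q'} → P' ⪰ P → Q' ⪰ Q → (P' ∥ Q') ⪰ (P ∥ Q)
  s-⊕    : ∀ {P P' Q Q'} → P' ⪰ P → Q' ⪰ Q → (P' ⊕ Q') ⪰ (P ⊕ Q)
  s-res  : ∀ {P P' L} → P' ⪰ P → res P' L ⪰ res P L
  s-rel  : ∀ {P P' f} → P' ⪰ P → rel P' f ⪰ rel P f
  s-rec  : ∀ {P P'} → P' ⪰ P → Guarded zero P → (P' [ rec P /x]) ⪰ rec P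

_⪰⁺_ : Term → Term → Set
_⪰⁺_ = TransClosure _⪰_

-- A clock step of a well-formed term only ever makes the term larger for ⪰:
-- σ.P becomes P, a μ is unfolded, and everything else ticks componentwise.
-- Hence, if P' ⪰ P and P' ticks (in the σ₂ sense) to P'₁, then P can tick in
-- the stricter σ₁ sense to some P₁ with P'₁ ⪰* P₁: the σ-prefixes that σ₂ may
-- skip are absorbed by ⪰, and the side condition on | transfers because
-- urgent actions of P are urgent in P'.  The μ case rests on the fact that a
-- clock step of P'[μx.P/x] with x guarded in P' is a step of P' followed by the
-- substitution.  Iterating along P ⪰⁺ P' gives the theorem, since every σ₁ step
-- is a σ₂ step.
module Submission where

open import Defs
open import Data.Product using (∃; _×_; _,_; proj₁; proj₂)
open import Data.Nat using (zero; suc; _≟_)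
open import Data.Nat.Properties using (suc-injective)
open import Data.Sum using (_⊎_; inj₁; inj₂; map₁; map₂)
open import Data.Empty using (⊥-elim)
open import Data.Unit using (tt)
open import Function using (_∘_)
open import Relation.Nullary using (¬_; yes; no)
open import Relation.Binary.PropositionalEquality
  using (_≡_; _≢_; refl; cong; cong₂; sym; trans; module ≡-Reasoning)
  renaming (subst to ≡-subst)
open import Relation.Binary.Construct.Closure.Transitive using ([_]; _∷_; _++_)
open import Relation.Binary.Construct.Closure.ReflexiveTransitive
  using (Star; ε; _◅_; _◅◅_; gmap)

rename-cong : ∀ {ρ ρ'} → (∀ n → ρ n ≡ ρ' n) → ∀ P → rename ρ P ≡ rename ρ' P
rename-cong e nil       = refl
rename-cong e (var n)   = cong var (e n)
rename-cong e (pre α P) = cong (pre α) (rename-cong e P)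
rename-cong e (sig P)   = cong sig (rename-cong e P)
rename-cong e (P ⊕ Q)   = cong₂ _⊕_ (rename-cong e P) (rename-cong e Q)
rename-cong e (P ∥ Q)   = cong₂ _∥_ (rename-cong e P) (rename-cong e Q)
rename-cong e (res P L) = cong (λ X → res X L) (rename-cong e P)
rename-cong e (rel P f) = cong (λ X → rel X f) (rename-cong e P)
rename-cong e (rec P)   = cong rec (rename-cong ext-e P)
  where
  ext-e : ∀ n → ext _ n ≡ ext _ n
  ext-e zero    = refl
  ext-e (suc n) = cong suc (e n)

subst-cong : ∀ {s t} → (∀ n → s n ≡ t n) → ∀ P → subst s P ≡ subst t P
subst-cong e nil       = refl
subst-cong e (var n)   = e n
subst-cong e (pre α P) = cong (pre α) (subst-cong e P)
subst-cong e (sig P)   = cong sig (subst-cong e P)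
subst-cong e (P ⊕ Q)   = cong₂ _⊕_ (subst-cong e P) (subst-cong e Q)
subst-cong e (P ∥ Q)   = cong₂ _∥_ (subst-cong e P) (subst-cong e Q)
subst-cong e (res P L) = cong (λ X → res X L) (subst-cong e P)
subst-cong e (rel P f) = cong (λ X → rel X f) (subst-cong e P)
subst-cong e (rec P)   = cong rec (subst-cong exts-e P)
  where
  exts-e : ∀ n → exts _ n ≡ exts _ n
  exts-e zero    = refl
  exts-e (suc n) = cong (rename suc) (e n)

rename-rename : ∀ ρ ρ' P → rename ρ (rename ρ' P) ≡ rename (ρ ∘ ρ') P
rename-rename ρ ρ' nil       = refl
rename-rename ρ ρ' (var n)   = refl
rename-rename ρ ρ' (pre α P) = cong (pre α) (rename-rename ρ ρ' P)
rename-rename ρ ρ' (sig P)   = cong sig (rename-rename ρ ρ' P)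
rename-rename ρ ρ' (P ⊕ Q)   = cong₂ _⊕_ (rename-rename ρ ρ' P) (rename-rename ρ ρ' Q)
rename-rename ρ ρ' (P ∥ Q)   = cong₂ _∥_ (rename-rename ρ ρ' P) (rename-rename ρ ρ' Q)
rename-rename ρ ρ' (res P L) = cong (λ X → res X L) (rename-rename ρ ρ' P)
rename-rename ρ ρ' (rel P f) = cong (λ X → rel X f) (rename-rename ρ ρ' P)
rename-rename ρ ρ' (rec P)   =
  cong rec (trans (rename-rename (ext ρ) (ext ρ') P) (rename-cong ext-∘ P))
  where
  ext-∘ : ∀ n → ext ρ (ext ρ' n) ≡ ext (ρ ∘ ρ') n
  ext-∘ zero    = refl
  ext-∘ (suc n) = refl

rename-subst : ∀ ρ s P → rename ρ (subst s P) ≡ subst (rename ρ ∘ s) P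
rename-subst ρ s nil       = refl
rename-subst ρ s (var n)   = refl
rename-subst ρ s (pre α P) = cong (pre α) (rename-subst ρ s P)
rename-subst ρ s (sig P)   = cong sig (rename-subst ρ s P)
rename-subst ρ s (P ⊕ Q)   = cong₂ _⊕_ (rename-subst ρ s P) (rename-subst ρ s Q)
rename-subst ρ s (P ∥ Q)   = cong₂ _∥_ (rename-subst ρ s P) (rename-subst ρ s Q)
rename-subst ρ s (res P L) = cong (λ X → res X L) (rename-subst ρ s P)
rename-subst ρ s (rel P f) = cong (λ X → rel X f) (rename-subst ρ s P)
rename-subst ρ s (rec P)   =
  cong rec (trans (rename-subst (ext ρ) (exts s) P) (subst-cong ext-exts P))
  where
  ext-exts : ∀ n → rename (ext ρ) (exts s n) ≡ exts (rename ρ ∘ s) n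
  ext-exts zero    = refl
  ext-exts (suc n) = trans (rename-rename (ext ρ) suc (s n)) (sym (rename-rename suc ρ (s n)))

subst-rename : ∀ s ρ P → subst s (rename ρ P) ≡ subst (s ∘ ρ) P
subst-rename s ρ nil       = refl
subst-rename s ρ (var n)   = refl
subst-rename s ρ (pre α P) = cong (pre α) (subst-rename s ρ P)
subst-rename s ρ (sig P)   = cong sig (subst-rename s ρ P)
subst-rename s ρ (P ⊕ Q)   = cong₂ _⊕_ (subst-rename s ρ P) (subst-rename s ρ Q)
subst-rename s ρ (P ∥ Q)   = cong₂ _∥_ (subst-rename s ρ P) (subst-rename s ρ Q)
subst-rename s ρ (res P L) = cong (λ X → res X L) (subst-rename s ρ P)
subst-rename s ρ (rel P f) = cong (λ X → rel X f) (subst-rename s ρ P)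
subst-rename s ρ (rec P)   =
  cong rec (trans (subst-rename (exts s) (ext ρ) P) (subst-cong exts-ext P))
  where
  exts-ext : ∀ n → exts s (ext ρ n) ≡ exts (s ∘ ρ) n
  exts-ext zero    = refl
  exts-ext (suc n) = refl

subst-subst : ∀ s t P → subst s (subst t P) ≡ subst (subst s ∘ t) P
subst-subst s t nil       = refl
subst-subst s t (var n)   = refl
subst-subst s t (pre α P) = cong (pre α) (subst-subst s t P)
subst-subst s t (sig P)   = cong sig (subst-subst s t P)
subst-subst s t (P ⊕ Q)   = cong₂ _⊕_ (subst-subst s t P) (subst-subst s t Q)
subst-subst s t (P ∥ Q)   = cong₂ _∥_ (subst-subst s t P) (subst-subst s t Q)
subst-subst s t (res P L) = cong (λ X → res X L) (subst-subst s t P)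
subst-subst s t (rel P f) = cong (λ X → rel X f) (subst-subst s t P)
subst-subst s t (rec P)   =
  cong rec (trans (subst-subst (exts s) (exts t) P) (subst-cong exts-exts P))
  where
  exts-exts : ∀ n → subst (exts s) (exts t n) ≡ exts (subst s ∘ t) n
  exts-exts zero    = refl
  exts-exts (suc n) = trans (subst-rename (exts s) suc (t n)) (sym (rename-subst suc s (t n)))

subst-var : ∀ P → subst var P ≡ P
subst-var nil       = refl
subst-var (var n)   = refl
subst-var (pre α P) = cong (pre α) (subst-var P)
subst-var (sig P)   = cong sig (subst-var P)
subst-var (P ⊕ Q)   = cong₂ _⊕_ (subst-var P) (subst-var Q)
subst-var (P ∥ Q)   = cong₂ _∥_ (subst-var P) (subst-var Q)
subst-var (res P L) = cong (λ X → res X L) (subst-var P)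
subst-var (rel P f) = cong (λ X → rel X f) (subst-var P)
subst-var (rec P)   = cong rec (trans (subst-cong exts-var P) (subst-var P))
  where
  exts-var : ∀ n → exts var n ≡ var n
  exts-var zero    = refl
  exts-var (suc n) = refl

subst-[/x] : ∀ s T P → subst s (P [ T /x]) ≡ subst (exts s) P [ subst s T /x]
subst-[/x] s T P = begin
  subst s (subst (sub0 T) P)                     ≡⟨ subst-subst s (sub0 T) P ⟩
  subst (subst s ∘ sub0 T) P                     ≡⟨ subst-cong pointwise P ⟩
  subst (subst (sub0 (subst s T)) ∘ exts s) P    ≡˘⟨ subst-subst (sub0 (subst s T)) (exts s) P ⟩
  subst (sub0 (subst s T)) (subst (exts s) P)    ∎
  where
  open ≡-Reasoning
  pointwise : ∀ n → subst s (sub0 T n) ≡ subst (sub0 (subst s T)) (exts s n)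
  pointwise zero    = refl
  pointwise (suc m) = sym (trans (subst-rename (sub0 (subst s T)) suc (s m)) (subst-var (s m)))

Guarded-rename : ∀ ρ j P → (∀ n → Guarded n P ⊎ ρ n ≢ j) → Guarded j (rename ρ P)
Guarded-rename ρ j nil       h = tt
Guarded-rename ρ j (var n)   h with h n
... | inj₁ n≢n  = ⊥-elim (n≢n refl)
... | inj₂ ρn≢j = ρn≢j
Guarded-rename ρ j (pre α P) h = tt
Guarded-rename ρ j (sig P)   h = Guarded-rename ρ j P h
Guarded-rename ρ j (P ⊕ Q)   h =
  Guarded-rename ρ j P (map₁ proj₁ ∘ h) , Guarded-rename ρ j Q (map₁ proj₂ ∘ h)
Guarded-rename ρ j (P ∥ Q)   h =
  Guarded-rename ρ j P (map₁ proj₁ ∘ h) , Guarded-rename ρ j Q (map₁ proj₂ ∘ h)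
Guarded-rename ρ j (res P L) h = Guarded-rename ρ j P h
Guarded-rename ρ j (rel P f) h = Guarded-rename ρ j P h
Guarded-rename ρ j (rec P)   h = Guarded-rename (ext ρ) (suc j) P h'
  where
  h' : ∀ n → Guarded n P ⊎ ext ρ n ≢ suc j
  h' zero    = inj₂ λ ()
  h' (suc n) = map₂ (_∘ suc-injective) (h n)

Guarded-rename-suc : ∀ {k} T → Guarded k T → Guarded (suc k) (rename suc T)
Guarded-rename-suc {k} T g = Guarded-rename suc (suc k) T h
  where
  h : ∀ m → Guarded m T ⊎ suc m ≢ suc k
  h m with m ≟ k
  ... | yes refl = inj₁ g
  ... | no m≢k   = inj₂ (m≢k ∘ suc-injective)

Guarded-subst : ∀ s k P → (∀ n → Guarded n P ⊎ Guarded k (s n)) → Guarded k (subst s P)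
Guarded-subst s k nil       h = tt
Guarded-subst s k (var n)   h with h n
... | inj₁ n≢n = ⊥-elim (n≢n refl)
... | inj₂ g   = g
Guarded-subst s k (pre α P) h = tt
Guarded-subst s k (sig P)   h = Guarded-subst s k P h
Guarded-subst s k (P ⊕ Q)   h =
  Guarded-subst s k P (map₁ proj₁ ∘ h) , Guarded-subst s k Q (map₁ proj₂ ∘ h)
Guarded-subst s k (P ∥ Q)   h =
  Guarded-subst s k P (map₁ proj₁ ∘ h) , Guarded-subst s k Q (map₁ proj₂ ∘ h)
Guarded-subst s k (res P L) h = Guarded-subst s k P h
Guarded-subst s k (rel P f) h = Guarded-subst s k P h
Guarded-subst s k (rec P)   h = Guarded-subst (exts s) (suc k) P h'
  where
  h' : ∀ n → Guarded n P ⊎ Guarded (suc k) (exts s n)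
  h' zero    = inj₂ λ ()
  h' (suc n) = map₂ (Guarded-rename-suc (s n)) (h n)

Guarded-subst⁻¹ : ∀ s k P → s k ≡ var k → Guarded k (subst s P) → Guarded k P
Guarded-subst⁻¹ s k nil       e g = tt
Guarded-subst⁻¹ s k (var .k)  e g refl = ≡-subst (Guarded k) e g refl
Guarded-subst⁻¹ s k (pre α P) e g = tt
Guarded-subst⁻¹ s k (sig P)   e g = Guarded-subst⁻¹ s k P e g
Guarded-subst⁻¹ s k (P ⊕ Q)   e (g , h) = Guarded-subst⁻¹ s k P e g , Guarded-subst⁻¹ s k Q e h
Guarded-subst⁻¹ s k (P ∥ Q)   e (g , h) = Guarded-subst⁻¹ s k P e g , Guarded-subst⁻¹ s k Q e h
Guarded-subst⁻¹ s k (res P L) e g = Guarded-subst⁻¹ s k P e g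
Guarded-subst⁻¹ s k (rel P f) e g = Guarded-subst⁻¹ s k P e g
Guarded-subst⁻¹ s k (rec P)   e g = Guarded-subst⁻¹ (exts s) (suc k) P (cong (rename suc) e) g

WF-subst⁻¹ : ∀ s P → WF (subst s P) → WF P
WF-subst⁻¹ s nil       w = tt
WF-subst⁻¹ s (var n)   w = tt
WF-subst⁻¹ s (pre α P) w = WF-subst⁻¹ s P w
WF-subst⁻¹ s (sig P)   w = WF-subst⁻¹ s P w
WF-subst⁻¹ s (P ⊕ Q)   (w , v) = WF-subst⁻¹ s P w , WF-subst⁻¹ s Q v
WF-subst⁻¹ s (P ∥ Q)   (w , v) = WF-subst⁻¹ s P w , WF-subst⁻¹ s Q v
WF-subst⁻¹ s (res P L) w = WF-subst⁻¹ s P w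
WF-subst⁻¹ s (rel P f) w = WF-subst⁻¹ s P w
WF-subst⁻¹ s (rec P)   (g , w) = Guarded-subst⁻¹ (exts s) 0 P refl g , WF-subst⁻¹ (exts s) P w

∈U-subst : ∀ {α P} s → α ∈U P → α ∈U subst s P
∈U-subst s u-pre          = u-pre
∈U-subst s (u-⊕l u)       = u-⊕l (∈U-subst s u)
∈U-subst s (u-⊕r u)       = u-⊕r (∈U-subst s u)
∈U-subst s (u-∥l u)       = u-∥l (∈U-subst s u)
∈U-subst s (u-∥r u)       = u-∥r (∈U-subst s u)
∈U-subst s (u-sync a u v) = u-sync a (∈U-subst s u) (∈U-subst s v)
∈U-subst s (u-res u α∉L)  = u-res (∈U-subst s u) α∉L
∈U-subst s (u-rel u)      = u-rel (∈U-subst s u)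
∈U-subst s (u-rec u)      = u-rec (∈U-subst (exts s) u)

infix 4 _⪰*_

_⪰*_ : Term → Term → Set
_⪰*_ = Star _⪰_

⪰*⇒⪰⁺ : ∀ {P Q} → P ⪰* Q → P ⪰⁺ Q
⪰*⇒⪰⁺ ε        = [ s-refl ]
⪰*⇒⪰⁺ (p ◅ ps) = p ∷ ⪰*⇒⪰⁺ ps

⪰*-⊕ : ∀ {P P' Q Q'} → P' ⪰* P → Q' ⪰* Q → (P' ⊕ Q') ⪰* (P ⊕ Q)
⪰*-⊕ ps qs = gmap (λ X → X ⊕ _) (λ p → s-⊕ p s-refl) ps ◅◅ gmap (λ X → _ ⊕ X) (s-⊕ s-refl) qs

⪰*-∥ : ∀ {P P' Q Q'} → P' ⪰* P → Q' ⪰* Q → (P' ∥ Q') ⪰* (P ∥ Q)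
⪰*-∥ ps qs = gmap (λ X → X ∥ _) (λ p → s-∥ p s-refl) ps ◅◅ gmap (λ X → _ ∥ X) (s-∥ s-refl) qs

⪰*-res : ∀ {P P' L} → P' ⪰* P → res P' L ⪰* res P L
⪰*-res = gmap (λ X → res X _) s-res

⪰*-rel : ∀ {P P' f} → P' ⪰* P → rel P' f ⪰* rel P f
⪰*-rel = gmap (λ X → rel X _) s-rel

⪰-Guarded : ∀ k {P' P} → P' ⪰ P → Guarded k P → Guarded k P'
⪰-Guarded k s-refl      g       = g
⪰-Guarded k s-sig       g       = g
⪰-Guarded k (s-∥ p q)   (g , h) = ⪰-Guarded k p g , ⪰-Guarded k q h
⪰-Guarded k (s-⊕ p q)   (g , h) = ⪰-Guarded k p g , ⪰-Guarded k q h
⪰-Guarded k (s-res p)   g       = ⪰-Guarded k p g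
⪰-Guarded k (s-rel p)   g       = ⪰-Guarded k p g
⪰-Guarded k (s-rec {P} {P'} p _) g = Guarded-subst (sub0 (rec P)) k P' h
  where
  h : ∀ n → Guarded n P' ⊎ Guarded k (sub0 (rec P) n)
  h zero = inj₂ g
  h (suc m) with m ≟ k
  ... | yes refl = inj₁ (⪰-Guarded (suc k) p g)
  ... | no m≢k   = inj₂ m≢k

⪰-WF : ∀ {P' P} → WF P' → P' ⪰ P → WF P
⪰-WF w       s-refl    = w
⪰-WF w       s-sig     = w
⪰-WF (w , v) (s-∥ p q) = ⪰-WF w p , ⪰-WF v q
⪰-WF (w , v) (s-⊕ p q) = ⪰-WF w p , ⪰-WF v q
⪰-WF w       (s-res p) = ⪰-WF w p
⪰-WF w       (s-rel p) = ⪰-WF w p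
⪰-WF w       (s-rec {P} {P'} p g) = g , ⪰-WF (WF-subst⁻¹ (sub0 (rec P)) P' w) p

⪰-∈U : ∀ {α P' P} → P' ⪰ P → α ∈U P → α ∈U P'
⪰-∈U s-refl      u              = u
⪰-∈U (s-∥ p q)   (u-∥l u)       = u-∥l (⪰-∈U p u)
⪰-∈U (s-∥ p q)   (u-∥r u)       = u-∥r (⪰-∈U q u)
⪰-∈U (s-∥ p q)   (u-sync a u v) = u-sync a (⪰-∈U p u) (⪰-∈U q v)
⪰-∈U (s-⊕ p q)   (u-⊕l u)       = u-⊕l (⪰-∈U p u)
⪰-∈U (s-⊕ p q)   (u-⊕r u)       = u-⊕r (⪰-∈U q u)
⪰-∈U (s-res p)   (u-res u α∉L)  = u-res (⪰-∈U p u) α∉L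
⪰-∈U (s-rel p)   (u-rel u)      = u-rel (⪰-∈U p u)
⪰-∈U (s-rec p _) (u-rec u)      = ∈U-subst _ (⪰-∈U p u)

subst-⪰ : ∀ s {P' P} → P' ⪰ P → subst s P' ⪰ subst s P
subst-⪰ s s-refl    = s-refl
subst-⪰ s s-sig     = s-sig
subst-⪰ s (s-∥ p q) = s-∥ (subst-⪰ s p) (subst-⪰ s q)
subst-⪰ s (s-⊕ p q) = s-⊕ (subst-⪰ s p) (subst-⪰ s q)
subst-⪰ s (s-res p) = s-res (subst-⪰ s p)
subst-⪰ s (s-rel p) = s-rel (subst-⪰ s p)
subst-⪰ s (s-rec {P} {P'} p g) =
  ≡-subst (_⪰ rec (subst (exts s) P)) (sym (subst-[/x] s (rec P) P'))
    (s-rec (subst-⪰ (exts s) p) (Guarded-subst (exts s) 0 P h))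
  where
  h : ∀ n → Guarded n P ⊎ Guarded 0 (exts s n)
  h zero    = inj₁ g
  h (suc m) = inj₂ (Guarded-rename suc 0 (s m) λ _ → inj₂ λ ())

subst-⪰* : ∀ s {P' P} → P' ⪰* P → subst s P' ⪰* subst s P
subst-⪰* s = gmap (subst s) (subst-⪰ s)

σ₁⇒σ₂ : ∀ {P Q} → P ─σ[ one ]→ Q → P ─σ[ two ]→ Q
σ₁⇒σ₂ c-nil        = c-nil
σ₁⇒σ₂ c-pre        = c-pre
σ₁⇒σ₂ c-sig        = c-sig
σ₁⇒σ₂ (c-rec t)    = c-rec (σ₁⇒σ₂ t)
σ₁⇒σ₂ (c-res t)    = c-res (σ₁⇒σ₂ t)
σ₁⇒σ₂ (c-rel t)    = c-rel (σ₁⇒σ₂ t)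
σ₁⇒σ₂ (c-⊕ t u)    = c-⊕ (σ₁⇒σ₂ t) (σ₁⇒σ₂ u)
σ₁⇒σ₂ (c-∥ t u ¬τ) = c-∥ (σ₁⇒σ₂ t) (σ₁⇒σ₂ u) ¬τ

IsVar : Term → Set
IsVar T = ∃ λ m → T ≡ var m

var-stuck : ∀ {T i R} → IsVar T → ¬ T ─σ[ i ]→ R
var-stuck (m , refl) ()

-- Asking for a variable (rather than a term that cannot tick) keeps the
-- side condition stable under exts.
subst-step⁻¹ : ∀ {i} s P {R} → (∀ n → Guarded n P ⊎ IsVar (s n)) → subst s P ─σ[ i ]→ R
             → ∃ λ P₁ → (P ─σ[ i ]→ P₁) × (R ≡ subst s P₁)
subst-step⁻¹ s nil       h c-nil = nil , c-nil , refl
subst-step⁻¹ s (var n)   h t with h n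
... | inj₁ n≢n = ⊥-elim (n≢n refl)
... | inj₂ sn  = ⊥-elim (var-stuck sn t)
subst-step⁻¹ s (pre α P) h c-pre = pre α P , c-pre , refl
subst-step⁻¹ s (sig P)   h c-sig = P , c-sig , refl
subst-step⁻¹ s (sig P)   h (c-sig2 t) with subst-step⁻¹ s P h t
... | P₁ , t' , refl = P₁ , c-sig2 t' , refl
subst-step⁻¹ s (P ⊕ Q)   h (c-⊕ t u)
  with subst-step⁻¹ s P (map₁ proj₁ ∘ h) t | subst-step⁻¹ s Q (map₁ proj₂ ∘ h) u
... | _ , t' , refl | _ , u' , refl = _ , c-⊕ t' u' , refl
subst-step⁻¹ s (P ∥ Q)   h (c-∥ t u ¬τ)
  with subst-step⁻¹ s P (map₁ proj₁ ∘ h) t | subst-step⁻¹ s Q (map₁ proj₂ ∘ h) u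
... | _ , t' , refl | _ , u' , refl = _ , c-∥ t' u' (¬τ ∘ ∈U-subst s) , refl
subst-step⁻¹ s (res P L) h (c-res t) with subst-step⁻¹ s P h t
... | _ , t' , refl = _ , c-res t' , refl
subst-step⁻¹ s (rel P f) h (c-rel t) with subst-step⁻¹ s P h t
... | _ , t' , refl = _ , c-rel t' , refl
subst-step⁻¹ s (rec P)   h (c-rec t) with subst-step⁻¹ (exts s) P h' t
  where
  h' : ∀ n → Guarded n P ⊎ IsVar (exts s n)
  h' zero    = inj₂ (0 , refl)
  h' (suc n) = map₂ (λ (m , e) → suc m , cong (rename suc) e) (h n)
... | P₁ , t' , refl = P₁ [ rec P /x] , c-rec t' , sym (subst-[/x] s (rec P) P₁)

[/x]-step⁻¹ : ∀ {i} T P {R} → Guarded 0 P → (P [ T /x]) ─σ[ i ]→ R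
            → ∃ λ P₁ → (P ─σ[ i ]→ P₁) × (R ≡ P₁ [ T /x])
[/x]-step⁻¹ T P g = subst-step⁻¹ (sub0 T) P h
  where
  h : ∀ n → Guarded n P ⊎ IsVar (sub0 T n)
  h zero    = inj₁ g
  h (suc m) = inj₂ (m , refl)

σ₂-⪰* : ∀ {P P₁} → WF P → P ─σ[ two ]→ P₁ → P₁ ⪰* P
σ₂-⪰* w       c-nil        = ε
σ₂-⪰* w       c-pre        = ε
σ₂-⪰* w       c-sig        = s-sig ◅ ε
σ₂-⪰* (g , w) (c-rec {P = P} t) = subst-⪰* (sub0 (rec P)) (σ₂-⪰* w t) ◅◅ (s-rec s-refl g ◅ ε)
σ₂-⪰* w       (c-res t)    = ⪰*-res (σ₂-⪰* w t)
σ₂-⪰* w       (c-rel t)    = ⪰*-rel (σ₂-⪰* w t)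
σ₂-⪰* (w , v) (c-⊕ t u)    = ⪰*-⊕ (σ₂-⪰* w t) (σ₂-⪰* v u)
σ₂-⪰* (w , v) (c-∥ t u _)  = ⪰*-∥ (σ₂-⪰* w t) (σ₂-⪰* v u)
σ₂-⪰* w       (c-sig2 t)   = σ₂-⪰* w t ◅◅ (s-sig ◅ ε)

σ₂⇒σ₁ : ∀ {P P₁} → WF P → P ─σ[ two ]→ P₁ → ∃ λ Q → (P ─σ[ one ]→ Q) × (P₁ ⪰* Q)
σ₂⇒σ₁ w       c-nil      = _ , c-nil , ε
σ₂⇒σ₁ w       c-pre      = _ , c-pre , ε
σ₂⇒σ₁ w       c-sig      = _ , c-sig , ε
σ₂⇒σ₁ (g , w) (c-rec {P = P} t) with σ₂⇒σ₁ w t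
... | _ , t' , ps = _ , c-rec t' , subst-⪰* (sub0 (rec P)) ps
σ₂⇒σ₁ w       (c-res t) with σ₂⇒σ₁ w t
... | _ , t' , ps = _ , c-res t' , ⪰*-res ps
σ₂⇒σ₁ w       (c-rel t) with σ₂⇒σ₁ w t
... | _ , t' , ps = _ , c-rel t' , ⪰*-rel ps
σ₂⇒σ₁ (w , v) (c-⊕ t u) with σ₂⇒σ₁ w t | σ₂⇒σ₁ v u
... | _ , t' , ps | _ , u' , qs = _ , c-⊕ t' u' , ⪰*-⊕ ps qs
σ₂⇒σ₁ (w , v) (c-∥ t u ¬τ) with σ₂⇒σ₁ w t | σ₂⇒σ₁ v u
... | _ , t' , ps | _ , u' , qs = _ , c-∥ t' u' ¬τ , ⪰*-∥ ps qs
σ₂⇒σ₁ w       (c-sig2 t) = _ , c-sig , σ₂-⪰* w t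

⪰-σ₂⇒σ₁ : ∀ {P' P P'₁} → WF P' → P' ⪰ P → P' ─σ[ two ]→ P'₁
        → ∃ λ P₁ → (P ─σ[ one ]→ P₁) × (P'₁ ⪰* P₁)
⪰-σ₂⇒σ₁ w s-refl t = σ₂⇒σ₁ w t
⪰-σ₂⇒σ₁ w s-sig  t = _ , c-sig , σ₂-⪰* w t
⪰-σ₂⇒σ₁ (w , v) (s-∥ p q) (c-∥ t u ¬τ) with ⪰-σ₂⇒σ₁ w p t | ⪰-σ₂⇒σ₁ v q u
... | _ , t' , ps | _ , u' , qs = _ , c-∥ t' u' (¬τ ∘ ⪰-∈U (s-∥ p q)) , ⪰*-∥ ps qs
⪰-σ₂⇒σ₁ (w , v) (s-⊕ p q) (c-⊕ t u) with ⪰-σ₂⇒σ₁ w p t | ⪰-σ₂⇒σ₁ v q u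
... | _ , t' , ps | _ , u' , qs = _ , c-⊕ t' u' , ⪰*-⊕ ps qs
⪰-σ₂⇒σ₁ w (s-res p) (c-res t) with ⪰-σ₂⇒σ₁ w p t
... | _ , t' , ps = _ , c-res t' , ⪰*-res ps
⪰-σ₂⇒σ₁ w (s-rel p) (c-rel t) with ⪰-σ₂⇒σ₁ w p t
... | _ , t' , ps = _ , c-rel t' , ⪰*-rel ps
⪰-σ₂⇒σ₁ w (s-rec {P} {P'} p g) t with [/x]-step⁻¹ (rec P) P' (⪰-Guarded 0 p g) t
... | _ , t' , refl with ⪰-σ₂⇒σ₁ (WF-subst⁻¹ (sub0 (rec P)) P' w) p t'
... | P₁ , t'' , ps = P₁ [ rec P /x] , c-rec t'' , subst-⪰* (sub0 (rec P)) ps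

lemma11 : ∀ {P P' P₁} → WF P → WF P' → P ⪰⁺ P' → P ─σ[ two ]→ P₁
          → ∃ λ P₁' → (P' ─σ[ one ]→ P₁') × (P₁ ⪰⁺ P₁')
lemma11 w _ [ p ] t with ⪰-σ₂⇒σ₁ w p t
... | Q , t' , ps = Q , t' , ⪰*⇒⪰⁺ ps
lemma11 w w' (p ∷ ps) t with ⪰-σ₂⇒σ₁ w p t
... | _ , t' , qs with lemma11 (⪰-WF w p) w' ps (σ₁⇒σ₂ t')
... | R , t'' , rs = R , t'' , ⪰*⇒⪰⁺ qs ++ rs
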